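{- There is a constant $c>0$ such that every graph $G$ with $n$ vertices and bandwidth $b$ admits a disk-link drawing on a grid of size $W\times H$ with $W\le c\,b\,n$ and $H\le c\,b^2$.
   Context: A simple graph $G=(V,E)$ has bandwidth $b$ if there is a total ordering $\prec$ of $V$ such that for every edge $(u,v)$ with $u\prec v$, the set $\{w\in V: u\prec w\preceq v\}$ has at most $b$ elements. A disk-link drawing of a graph maps each vertex to a distinct open disk of radius $\frac12$ and each edge to the straight-line segment connecting the centers of the disks of its endpoints, such that (i) each disk center has integer coordinates, (ii) no two disks intersect, and (iii) no disk is intersected by the segment of a non-incident edge. A drawing is on a grid of size $W\times H$ if the minimum axis-aligned box containing all disk centers has side lengths $W-1$ and $H-1$.
   Formalization: The plane is taken as ℚ × ℚ, so the open disks and the straight-line segments of the drawing consist of points with rational coordinates. -}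

module Defs where

open import Data.Nat as ℕ using (ℕ; _≤_; _<_; _∸_; _*_)
open import Data.Integer as ℤ using (ℤ; +_)
open import Data.Rational as ℚ using (ℚ; 0ℚ; 1ℚ; ½)
open import Data.Fin using (Fin; toℕ)
open import Data.Product using (Σ; _×_; _,_; ∃; ∃-syntax)
open import Relation.Binary.PropositionalEquality using (_≡_; _≢_)
open import Relation.Nullary using (¬_)
open import Function.Definitions using (Injective)

record SimpleGraph (n : ℕ) : Set₁ where
  field
    Adj     : Fin n → Fin n → Set
    sym     : ∀ {u v} → Adj u v → Adj v u
    irrefl  : ∀ {u} → ¬ Adj u u
open SimpleGraph public

-- G has bandwidth b: there is a total order on V (given as an injective,
-- hence bijective, position map σ : Fin n → Fin n, u ≺ v iff σ u < σ v) such
-- that for every edge (u,v) with u ≺ v the set {w : u ≺ w ⪯ v}, whose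
-- cardinality is σ v ∸ σ u, has at most b elements.
HasBandwidth : ∀ {n} → SimpleGraph n → ℕ → Set
HasBandwidth {n} G b =
  Σ (Fin n → Fin n) λ σ →
    Injective _≡_ _≡_ σ ×
    (∀ u v → Adj G u v → toℕ (σ u) < toℕ (σ v) → toℕ (σ v) ∸ toℕ (σ u) ≤ b)

-- Points of the plane with rational coordinates (ℚ stands in for ℝ).
Point : Set
Point = ℚ × ℚ

Grid : Set
Grid = ℤ × ℤ

embed : Grid → Point
embed (x , y) = (x ℚ./ 1 , y ℚ./ 1)

dist² : Point → Point → ℚ
dist² (x₁ , y₁) (x₂ , y₂) =
  ((x₁ ℚ.- x₂) ℚ.* (x₁ ℚ.- x₂)) ℚ.+ ((y₁ ℚ.- y₂) ℚ.* (y₁ ℚ.- y₂))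

InDisk : Grid → Point → Set
InDisk c p = dist² p (embed c) ℚ.< (½ ℚ.* ½)

OnSegment : Grid → Grid → Point → Set
OnSegment a b p =
  ∃[ t ] (0ℚ ℚ.≤ t × t ℚ.≤ 1ℚ ×
    p ≡ ( (ax ℚ.+ t ℚ.* (bx ℚ.- ax)) , (ay ℚ.+ t ℚ.* (by ℚ.- ay)) ))
  where
  ax = Data.Product.proj₁ (embed a)
  ay = Data.Product.proj₂ (embed a)
  bx = Data.Product.proj₁ (embed b)
  by = Data.Product.proj₂ (embed b)

DisksIntersect : Grid → Grid → Set
DisksIntersect c d = ∃[ p ] (InDisk c p × InDisk d p)

SegmentHitsDisk : Grid → Grid → Grid → Set
SegmentHitsDisk a b c = ∃[ p ] (OnSegment a b p × InDisk c p)

record DiskLinkDrawing {n : ℕ} (G : SimpleGraph n) : Set where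
  field
    pos       : Fin n → Grid
    distinct  : Injective _≡_ _≡_ pos
    disjoint  : ∀ u v → u ≢ v → ¬ DisksIntersect (pos u) (pos v)
    avoid     : ∀ u v w → Adj G u v → w ≢ u → w ≢ v →
                ¬ SegmentHitsDisk (pos u) (pos v) (pos w)
open DiskLinkDrawing public

-- The drawing fits on a W × H grid: all centres lie in an axis-parallel box
-- with side lengths W-1 and H-1 (so the minimum bounding box has size at most W × H).
OnGrid : ∀ {n} {G : SimpleGraph n} → DiskLinkDrawing G → ℕ → ℕ → Set
OnGrid {n} D W H =
  1 ≤ W × 1 ≤ H ×
  ∃[ x₀ ] ∃[ y₀ ] (∀ v →
    let (x , y) = pos D v in
    x₀ ℤ.≤ x × x ℤ.≤ x₀ ℤ.+ (+ (W ∸ 1)) ×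
    y₀ ℤ.≤ y × y ℤ.≤ y₀ ℤ.+ (+ (H ∸ 1)))

-- Put the vertex in position t of a bandwidth ordering at (K t, (t mod m)²), where
-- m = b + 1 and K = 2m: each block of m consecutive positions lies on a translate
-- of the parabola y = (x / K)², and chords within a block have slope < 1.  An edge
-- joins positions i < k with k − i < m.  A vertex outside [i, k] is a unit to the
-- left or right of the whole edge.  For a vertex j inside, t mod m wraps at most
-- once on [i, k]: without a wrap, i, j, k lie on one arc, and the cross product of
-- the chord with j is at least its width K (k − i) while the chord is shorter than
-- √2 K (k − i), so j is farther than ½ from the chord's line; with a wrap, j lies a
-- unit above or below both endpoints.

module Submission where

open import Defs hiding (sym)
import Data.Integer as ℤ
open import Data.Product using (_×_; _,_; proj₁; proj₂; ∃-syntax)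
open import Relation.Nullary using (¬_)
open import Relation.Binary.PropositionalEquality

module Plane where
  open import Level using (0ℓ)
  open ℤ using (+_)
  import Data.Nat as ℕ
  open ℕ using (ℕ)
  import Data.Nat.Properties as ℕₚ
  import Data.Integer.Properties as ℤₚ
  open import Data.Rational using (ℚ; 0ℚ; 1ℚ; ½; _+_; _-_; -_; _*_; _/_; _≤_; _<_; *≤*; *<*; nonNegative)
  open import Data.Rational.Literals using (fromℤ)
  import Data.Rational.Properties as ℚₚ
  open import Data.Sum using (inj₁; inj₂)
  open import Relation.Nullary.Decidable.Core using (dec⇒maybe)
  open import Tactic.RingSolver using (solve-∀)
  open import Tactic.RingSolver.Core.AlmostCommutativeRing using (AlmostCommutativeRing; fromCommutativeRing)

  ℚ-ring : AlmostCommutativeRing 0ℓ 0ℓ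
  ℚ-ring = fromCommutativeRing ℚₚ.+-*-commutativeRing (λ x → dec⇒maybe (0ℚ ℚₚ.≟ x))

  p≤q⇒0≤q-p : ∀ {p q} → p ≤ q → 0ℚ ≤ q - p
  p≤q⇒0≤q-p {p} {q} p≤q = subst (_≤ q - p) (e p) (ℚₚ.+-monoˡ-≤ (- p) p≤q)
    where
    e : ∀ p → p - p ≡ 0ℚ
    e = solve-∀ ℚ-ring

  0≤q-p⇒p≤q : ∀ {p q} → 0ℚ ≤ q - p → p ≤ q
  0≤q-p⇒p≤q {p} {q} 0≤q-p = subst₂ _≤_ (ℚₚ.+-identityʳ p) (e p q) (ℚₚ.+-monoʳ-≤ p 0≤q-p)
    where
    e : ∀ p q → p + (q - p) ≡ q
    e = solve-∀ ℚ-ring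

  p≤p+q : ∀ {p q} → 0ℚ ≤ q → p ≤ p + q
  p≤p+q {p} {q} 0≤q = subst (_≤ p + q) (ℚₚ.+-identityʳ p) (ℚₚ.+-monoʳ-≤ p 0≤q)

  q≤p+q : ∀ {p q} → 0ℚ ≤ p → q ≤ p + q
  q≤p+q {p} {q} 0≤p = subst (_≤ p + q) (ℚₚ.+-identityˡ q) (ℚₚ.+-monoˡ-≤ q 0≤p)

  0≤p*q : ∀ {p q} → 0ℚ ≤ p → 0ℚ ≤ q → 0ℚ ≤ p * q
  0≤p*q {p} {q} 0≤p 0≤q =
    ℚₚ.nonNegative⁻¹ _ {{ℚₚ.nonNeg*nonNeg⇒nonNeg p {{nonNegative 0≤p}} q {{nonNegative 0≤q}}}}

  0≤p*p : ∀ p → 0ℚ ≤ p * p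
  0≤p*p p with ℚₚ.≤-total 0ℚ p
  ... | inj₁ 0≤p = 0≤p*q 0≤p 0≤p
  ... | inj₂ p≤0 = subst (0ℚ ≤_) (e p) (0≤p*q (p≤q⇒0≤q-p p≤0) (p≤q⇒0≤q-p p≤0))
    where
    e : ∀ p → (0ℚ - p) * (0ℚ - p) ≡ p * p
    e = solve-∀ ℚ-ring

  [p-q]²≡[q-p]² : ∀ p q → (p - q) * (p - q) ≡ (q - p) * (q - p)
  [p-q]²≡[q-p]² = solve-∀ ℚ-ring

  ½≤1 : ½ ≤ 1ℚ
  ½≤1 = *≤* (ℤ.+≤+ (ℕ.s≤s ℕ.z≤n))

  ½≤p⇒¼≤p*p : ∀ {p} → ½ ≤ p → ½ * ½ ≤ p * p
  ½≤p⇒¼≤p*p {p} ½≤p =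
    0≤q-p⇒p≤q (subst (0ℚ ≤_) (e p) (ℚₚ.+-mono-≤ (0≤p*p (p - ½)) (p≤q⇒0≤q-p ½≤p)))
    where
    e : ∀ p → (p - ½) * (p - ½) + (p - ½) ≡ p * p - ½ * ½
    e = solve-∀ ℚ-ring

  1≤convex : ∀ {t u v} → 0ℚ ≤ t → t ≤ 1ℚ → 1ℚ ≤ u → 1ℚ ≤ v → 1ℚ ≤ (1ℚ - t) * u + t * v
  1≤convex {t} {u} {v} 0≤t t≤1 1≤u 1≤v = 0≤q-p⇒p≤q (subst (0ℚ ≤_) (e t u v)
    (ℚₚ.+-mono-≤ (0≤p*q (p≤q⇒0≤q-p t≤1) (p≤q⇒0≤q-p 1≤u))
                 (0≤p*q (p≤q⇒0≤q-p 0≤t) (p≤q⇒0≤q-p 1≤v))))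
    where
    e : ∀ t u v → (1ℚ - t) * (u - 1ℚ) + (t - 0ℚ) * (v - 1ℚ) ≡ ((1ℚ - t) * u + t * v) - 1ℚ
    e = solve-∀ ℚ-ring

  -- Written exactly as `embed` writes a coordinate, so that the coordinates of
  -- `point x y` below reduce to `ι x` and `ι y`.
  ι : ℕ → ℚ
  ι n = + n / 1

  private
    ι≡fromℤ : ∀ n → ι n ≡ fromℤ (+ n)
    ι≡fromℤ n = ℚₚ.↥p/↧p≡p (fromℤ (+ n))

  ι-homo-+ : ∀ m n → ι (m ℕ.+ n) ≡ ι m + ι n
  ι-homo-+ m n rewrite ι≡fromℤ m | ι≡fromℤ n | ℤₚ.*-identityʳ (+ m) | ℤₚ.*-identityʳ (+ n) = refl

  ι-homo-* : ∀ m n → ι (m ℕ.* n) ≡ ι m * ι n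
  ι-homo-* m n rewrite ι≡fromℤ m | ι≡fromℤ n | sym (ℤₚ.pos-* m n) = refl

  ι-mono-≤ : ∀ {m n} → m ℕ.≤ n → ι m ≤ ι n
  ι-mono-≤ {m} {n} m≤n rewrite ι≡fromℤ m | ι≡fromℤ n =
    *≤* (subst₂ ℤ._≤_ (sym (ℤₚ.*-identityʳ (+ m))) (sym (ℤₚ.*-identityʳ (+ n))) (ℤ.+≤+ m≤n))

  ι-mono-< : ∀ {m n} → m ℕ.< n → ι m < ι n
  ι-mono-< {m} {n} m<n rewrite ι≡fromℤ m | ι≡fromℤ n =
    *<* (subst₂ ℤ._<_ (sym (ℤₚ.*-identityʳ (+ m))) (sym (ℤₚ.*-identityʳ (+ n))) (ℤ.+<+ m<n))

  ι-+-gap : ∀ x d → ι (x ℕ.+ d) - ι x ≡ ι d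
  ι-+-gap x d = trans (cong (_- ι x) (ι-homo-+ x d)) (e (ι x) (ι d))
    where
    e : ∀ a d → (a + d) - a ≡ d
    e = solve-∀ ℚ-ring

  ι-+-gap² : ∀ x d → (ι x - ι (x ℕ.+ d)) * (ι x - ι (x ℕ.+ d)) ≡ ι (d ℕ.* d)
  ι-+-gap² x d = begin
    (ι x - ι (x ℕ.+ d)) * (ι x - ι (x ℕ.+ d))   ≡⟨ [p-q]²≡[q-p]² (ι x) (ι (x ℕ.+ d)) ⟩
    (ι (x ℕ.+ d) - ι x) * (ι (x ℕ.+ d) - ι x)   ≡⟨ cong (λ u → u * u) (ι-+-gap x d) ⟩
    ι d * ι d                                   ≡⟨ ι-homo-* d d ⟨
    ι (d ℕ.* d)                                 ∎
    where open ≡-Reasoning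

  ι-<⇒1≤- : ∀ {m n} → m ℕ.< n → 1ℚ ≤ ι n - ι m
  ι-<⇒1≤- {m} {n} m<n = 0≤q-p⇒p≤q (subst (0ℚ ≤_) (e (ι n) (ι m)) (p≤q⇒0≤q-p ιm+1≤ιn))
    where
    ιm+1≤ιn : ι m + 1ℚ ≤ ι n
    ιm+1≤ιn = subst (_≤ ι n) (trans (cong ι (ℕₚ.+-comm 1 m)) (ι-homo-+ m 1)) (ι-mono-≤ m<n)
    e : ∀ n m → n - (m + 1ℚ) ≡ (n - m) - 1ℚ
    e = solve-∀ ℚ-ring

  Near : ℚ → Set
  Near w = w * w < ½ * ½

  ½≤p⇒¬Near : ∀ {p} → ½ ≤ p → ¬ Near p
  ½≤p⇒¬Near ½≤p p*p<¼ = ℚₚ.<-irrefl refl (ℚₚ.≤-<-trans (½≤p⇒¼≤p*p ½≤p) p*p<¼)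

  Near-sym : ∀ p q → Near (p - q) → Near (q - p)
  Near-sym p q = subst (_< ½ * ½) ([p-q]²≡[q-p]² p q)

  data Axis : Set where
    horizontal vertical : Axis

  coordᴾ : Axis → Point → ℚ
  coordᴾ horizontal = proj₁
  coordᴾ vertical   = proj₂

  coord : Axis → Grid → ℚ
  coord a A = coordᴾ a (embed A)

  Apart : Axis → Grid → Grid → Set
  Apart a A B = 1ℚ ≤ coord a B - coord a A

  InDisk⇒Near : ∀ a C {p} → InDisk C p → Near (coordᴾ a p - coord a C)
  InDisk⇒Near horizontal C {p} p∈C = ℚₚ.≤-<-trans (p≤p+q (0≤p*p (proj₂ p - coord vertical C))) p∈C
  InDisk⇒Near vertical   C {p} p∈C = ℚₚ.≤-<-trans (q≤p+q (0≤p*p (proj₁ p - coord horizontal C))) p∈C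

  SegmentHitsDisk⇒Near : ∀ a A B C → SegmentHitsDisk A B C →
    ∃[ t ] (0ℚ ≤ t × t ≤ 1ℚ × Near ((coord a A + t * (coord a B - coord a A)) - coord a C))
  SegmentHitsDisk⇒Near horizontal _ _ C (p , (t , 0≤t , t≤1 , refl) , p∈C) =
    t , 0≤t , t≤1 , InDisk⇒Near horizontal C {p} p∈C
  SegmentHitsDisk⇒Near vertical _ _ C (p , (t , 0≤t , t≤1 , refl) , p∈C) =
    t , 0≤t , t≤1 , InDisk⇒Near vertical C {p} p∈C

  beyond⇒¬SegmentHitsDisk : ∀ a A B C → Apart a C A → Apart a C B → ¬ SegmentHitsDisk A B C
  beyond⇒¬SegmentHitsDisk a A B C C≪A C≪B hit with SegmentHitsDisk⇒Near a A B C hit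
  ... | t , 0≤t , t≤1 , near = ½≤p⇒¬Near (ℚₚ.≤-trans ½≤1 1≤w) near
    where
    e : ∀ a b c t → (1ℚ - t) * (a - c) + t * (b - c) ≡ (a + t * (b - a)) - c
    e = solve-∀ ℚ-ring
    1≤w : 1ℚ ≤ (coord a A + t * (coord a B - coord a A)) - coord a C
    1≤w = subst (1ℚ ≤_) (e (coord a A) (coord a B) (coord a C) t) (1≤convex 0≤t t≤1 C≪A C≪B)

  before⇒¬SegmentHitsDisk : ∀ a A B C → Apart a A C → Apart a B C → ¬ SegmentHitsDisk A B C
  before⇒¬SegmentHitsDisk a A B C A≪C B≪C hit with SegmentHitsDisk⇒Near a A B C hit
  ... | t , 0≤t , t≤1 , near =
    ½≤p⇒¬Near (ℚₚ.≤-trans ½≤1 1≤w) (Near-sym (coord a A + t * (coord a B - coord a A)) (coord a C) near)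
    where
    e : ∀ a b c t → (1ℚ - t) * (c - a) + t * (c - b) ≡ c - (a + t * (b - a))
    e = solve-∀ ℚ-ring
    1≤w : 1ℚ ≤ coord a C - (coord a A + t * (coord a B - coord a A))
    1≤w = subst (1ℚ ≤_) (e (coord a A) (coord a B) (coord a C) t) (1≤convex 0≤t t≤1 A≪C B≪C)

  Apart⇒¬DisksIntersect : ∀ a C D → Apart a C D → ¬ DisksIntersect C D
  Apart⇒¬DisksIntersect a C D C≪D (p , p∈C , p∈D) with ℚₚ.≤-total ½ (coordᴾ a p - coord a C)
  ... | inj₁ ½≤p-C = ½≤p⇒¬Near ½≤p-C (InDisk⇒Near a C p∈C)
  ... | inj₂ p-C≤½ = ½≤p⇒¬Near ½≤D-p (Near-sym (coordᴾ a p) (coord a D) (InDisk⇒Near a D p∈D))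
    where
    e : ∀ d c p → ((d - c) - 1ℚ) + (½ - (p - c)) ≡ (d - p) - ½
    e = solve-∀ ℚ-ring
    ½≤D-p : ½ ≤ coord a D - coordᴾ a p
    ½≤D-p = 0≤q-p⇒p≤q (subst (0ℚ ≤_) (e (coord a D) (coord a C) (coordᴾ a p))
              (ℚₚ.+-mono-≤ (p≤q⇒0≤q-p C≪D) (p≤q⇒0≤q-p p-C≤½)))

  X Y : Grid → ℚ
  X = coord horizontal
  Y = coord vertical

  cross : Grid → Grid → Grid → ℚ
  cross A B C = (X C - X A) * (Y B - Y A) - (X B - X A) * (Y C - Y A)

  lagrange : ∀ ax ay bx by cx cy t →
    let u = (ax + t * (bx - ax)) - cx
        v = (ay + t * (by - ay)) - cy
        z = (cx - ax) * (by - ay) - (bx - ax) * (cy - ay)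
    in (u * u + v * v) * ((ax - bx) * (ax - bx) + (ay - by) * (ay - by))
       ≡ (u * (bx - ax) + v * (by - ay)) * (u * (bx - ax) + v * (by - ay)) + z * z
  lagrange = solve-∀ ℚ-ring

  -- |cross A B C| / |AB| is the distance from C to the line AB.
  far-from-line⇒¬SegmentHitsDisk : ∀ A B C →
    dist² (embed A) (embed B) < ι 4 * (cross A B C * cross A B C) → ¬ SegmentHitsDisk A B C
  far-from-line⇒¬SegmentHitsDisk A B C |AB|²<4Z² (p , (t , _ , _ , refl) , p∈C) =
    ℚₚ.<-irrefl refl (begin-strict
      Z * Z                    ≤⟨ q≤p+q (0≤p*p dot) ⟩
      dot * dot + Z * Z        ≡⟨ lagrange (X A) (Y A) (X B) (Y B) (X C) (Y C) t ⟨
      S * D                    ≤⟨ ℚₚ.*-monoʳ-≤-nonNeg D {{nonNegative 0≤D}} (ℚₚ.<⇒≤ p∈C) ⟩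
      ½ * ½ * D                <⟨ ℚₚ.*-monoʳ-<-pos (½ * ½) |AB|²<4Z² ⟩
      ½ * ½ * (ι 4 * (Z * Z))  ≡⟨ e (Z * Z) ⟩
      Z * Z                    ∎)
    where
    open ℚₚ.≤-Reasoning
    Z = cross A B C
    S = dist² p (embed C)
    D = dist² (embed A) (embed B)
    0≤D : 0ℚ ≤ D
    0≤D = ℚₚ.+-mono-≤ (0≤p*p (X A - X B)) (0≤p*p (Y A - Y B))
    dot = ((X A + t * (X B - X A)) - X C) * (X B - X A) + ((Y A + t * (Y B - Y A)) - Y C) * (Y B - Y A)
    e : ∀ z → ½ * ½ * (ι 4 * z) ≡ z
    e = solve-∀ ℚ-ring

  SegmentHitsDisk-sym : ∀ A B C → SegmentHitsDisk A B C → SegmentHitsDisk B A C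
  SegmentHitsDisk-sym A B C (p , (t , 0≤t , t≤1 , refl) , p∈C) =
    p , (1ℚ - t , p≤q⇒0≤q-p t≤1 , 1-t≤1 , cong₂ _,_ (e (X A) (X B) t) (e (Y A) (Y B) t)) , p∈C
    where
    e : ∀ a b t → a + t * (b - a) ≡ b + (1ℚ - t) * (a - b)
    e = solve-∀ ℚ-ring
    e′ : ∀ t → t - 0ℚ ≡ 1ℚ - (1ℚ - t)
    e′ = solve-∀ ℚ-ring
    1-t≤1 : 1ℚ - t ≤ 1ℚ
    1-t≤1 = 0≤q-p⇒p≤q (subst (0ℚ ≤_) (e′ t) (p≤q⇒0≤q-p 0≤t))

  point : ℕ → ℕ → Grid
  point x y = + x , + y

  point-Apartˣ : ∀ {x y x′ y′} → x ℕ.< x′ → Apart horizontal (point x y) (point x′ y′)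
  point-Apartˣ = ι-<⇒1≤-

  point-Apartʸ : ∀ {x y x′ y′} → y ℕ.< y′ → Apart vertical (point x y) (point x′ y′)
  point-Apartʸ = ι-<⇒1≤-

  offsets-far-from-line⇒¬SegmentHitsDisk : ∀ x y dx dy ex ey z →
    ex ℕ.* dy ≡ dx ℕ.* ey ℕ.+ z → dx ℕ.* dx ℕ.+ dy ℕ.* dy ℕ.< 4 ℕ.* (z ℕ.* z) →
    ¬ SegmentHitsDisk (point x y) (point (x ℕ.+ dx) (y ℕ.+ dy)) (point (x ℕ.+ ex) (y ℕ.+ ey))
  offsets-far-from-line⇒¬SegmentHitsDisk x y dx dy ex ey z ex*dy≡dx*ey+z d²<4z² =
    far-from-line⇒¬SegmentHitsDisk A B C (subst₂ _<_ |AB|²≡ 4Z²≡ (ι-mono-< d²<4z²))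
    where
    open ≡-Reasoning
    A = point x y
    B = point (x ℕ.+ dx) (y ℕ.+ dy)
    C = point (x ℕ.+ ex) (y ℕ.+ ey)
    |AB|²≡ : ι (dx ℕ.* dx ℕ.+ dy ℕ.* dy) ≡ dist² (embed A) (embed B)
    |AB|²≡ = begin
      ι (dx ℕ.* dx ℕ.+ dy ℕ.* dy)      ≡⟨ ι-homo-+ (dx ℕ.* dx) (dy ℕ.* dy) ⟩
      ι (dx ℕ.* dx) + ι (dy ℕ.* dy)    ≡⟨ cong₂ _+_ (ι-+-gap² x dx) (ι-+-gap² y dy) ⟨
      dist² (embed A) (embed B)        ∎
    Z≡ : cross A B C ≡ ι z
    Z≡ = begin
      cross A B C                            ≡⟨ cong₂ _-_ (cong₂ _*_ (ι-+-gap x ex) (ι-+-gap y dy))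
                                                          (cong₂ _*_ (ι-+-gap x dx) (ι-+-gap y ey)) ⟩
      ι ex * ι dy - ι dx * ι ey              ≡⟨ cong₂ _-_ (ι-homo-* ex dy) (ι-homo-* dx ey) ⟨
      ι (ex ℕ.* dy) - ι (dx ℕ.* ey)          ≡⟨ cong (λ u → ι u - ι (dx ℕ.* ey)) ex*dy≡dx*ey+z ⟩
      ι (dx ℕ.* ey ℕ.+ z) - ι (dx ℕ.* ey)    ≡⟨ ι-+-gap (dx ℕ.* ey) z ⟩
      ι z                                    ∎
    4Z²≡ : ι (4 ℕ.* (z ℕ.* z)) ≡ ι 4 * (cross A B C * cross A B C)
    4Z²≡ = begin
      ι (4 ℕ.* (z ℕ.* z))                ≡⟨ ι-homo-* 4 (z ℕ.* z) ⟩
      ι 4 * ι (z ℕ.* z)                  ≡⟨ cong (ι 4 *_) (ι-homo-* z z) ⟩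
      ι 4 * (ι z * ι z)                  ≡⟨ cong (λ u → ι 4 * (u * u)) Z≡ ⟨
      ι 4 * (cross A B C * cross A B C)  ∎

open Plane
  using ( Apart; horizontal; vertical; point; point-Apartˣ; point-Apartʸ
        ; beyond⇒¬SegmentHitsDisk; before⇒¬SegmentHitsDisk; Apart⇒¬DisksIntersect
        ; SegmentHitsDisk-sym; offsets-far-from-line⇒¬SegmentHitsDisk )
open import Data.Nat using (ℕ; _≤_; _<_; _*_; _+_; _∸_; _%_; _<?_; suc; pred; s≤s; z≤n; NonZero; >-nonZero)
open import Data.Nat.Properties
open import Data.Nat.DivMod
import Data.Integer.Properties as ℤₚ
open import Data.Nat.Tactic.RingSolver using (solve-∀)
open import Data.Fin using (Fin; toℕ)
open import Data.Fin.Properties using (toℕ-injective; toℕ<n)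
open import Data.Product using (map₂; swap)
open import Function using (_∘_)
open import Relation.Binary.Definitions using (tri<; tri≈; tri>)
open import Relation.Nullary using (Dec; yes; no; contradiction)

[n+m]%d≡[n+m%d]%d : ∀ n m d .{{_ : NonZero d}} → (n + m) % d ≡ (n + m % d) % d
[n+m]%d≡[n+m%d]%d n m d = begin
  (n + m) % d               ≡⟨ %-distribˡ-+ n m d ⟩
  (n % d + m % d) % d       ≡⟨ cong (λ x → (n % d + x) % d) (m%n%n≡m%n m d) ⟨
  (n % d + m % d % d) % d   ≡⟨ %-distribˡ-+ n (m % d) d ⟨
  (n + m % d) % d           ∎
  where open ≡-Reasoning

n+m%d<d⇒[n+m]%d≡n+m%d : ∀ n m d .{{_ : NonZero d}} → n + m % d < d → (n + m) % d ≡ n + m % d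
n+m%d<d⇒[n+m]%d≡n+m%d n m d n+m%d<d = trans ([n+m]%d≡[n+m%d]%d n m d) (m<n⇒m%n≡m n+m%d<d)

m<o⇒m+n∸o<n : ∀ {m n o} → m < o → o ≤ m + n → m + n ∸ o < n
m<o⇒m+n∸o<n {m} {n} {o} m<o o≤m+n =
  subst (m + n ∸ o <_) (m+n∸m≡n o n) (∸-monoˡ-< (+-monoˡ-< n m<o) o≤m+n)

d≤n+m%d⇒[n+m]%d≡n+m%d∸d : ∀ n m d .{{_ : NonZero d}} → d ≤ n + m % d → n < d →
                          (n + m) % d ≡ n + m % d ∸ d
d≤n+m%d⇒[n+m]%d≡n+m%d∸d n m d d≤n+m%d n<d = begin
  (n + m) % d           ≡⟨ [n+m]%d≡[n+m%d]%d n m d ⟩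
  (n + m % d) % d       ≡⟨ m≤n⇒[n∸m]%m≡n%m d≤n+m%d ⟨
  (n + m % d ∸ d) % d   ≡⟨ m<n⇒m%n≡m (≤-trans (m<o⇒m+n∸o<n n<d d≤n+m%d) (<⇒≤ (m%n<n m d))) ⟩
  n + m % d ∸ d         ∎
  where open ≡-Reasoning

parabola : ℕ → ℕ → ℕ → ℕ → Grid
parabola K i r s = point (K * (s + i)) ((s + r) * (s + r))

parabola-chord-misses-disk : ∀ K i r l₁ l₂ → 0 < l₁ → 0 < l₂ → l₁ + l₂ + r + r < K →
  ¬ SegmentHitsDisk (parabola K i r 0) (parabola K i r (l₁ + l₂)) (parabola K i r l₁)
parabola-chord-misses-disk K i r l₁ l₂ 0<l₁ 0<l₂ L+r+r<K =
  subst₂ (λ B C → ¬ SegmentHitsDisk (point (K * i) (r * r)) B C) (on-parabola L) (on-parabola l₁)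
    (offsets-far-from-line⇒¬SegmentHitsDisk (K * i) (r * r) dx dy (K * l₁) (l₁ * (l₁ + r + r)) z
      (cross≡ K r l₁ l₂) d²<4z²)
  where
  L  = l₁ + l₂
  dx = K * L
  dy = L * (L + r + r)
  z  = K * L * (l₁ * l₂)
  on-parabola : ∀ s → point (K * i + K * s) (r * r + s * (s + r + r)) ≡ parabola K i r s
  on-parabola s = cong₂ point (e₁ K i s) (e₂ r s)
    where
    e₁ : ∀ K i s → K * i + K * s ≡ K * (s + i)
    e₁ = solve-∀
    e₂ : ∀ r s → r * r + s * (s + r + r) ≡ (s + r) * (s + r)
    e₂ = solve-∀
  cross≡ : ∀ K r l₁ l₂ → K * l₁ * ((l₁ + l₂) * (l₁ + l₂ + r + r))
                         ≡ K * (l₁ + l₂) * (l₁ * (l₁ + r + r)) + K * (l₁ + l₂) * (l₁ * l₂)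
  cross≡ = solve-∀
  4x≡[x+x]+[x+x] : ∀ x → 4 * x ≡ x + x + (x + x)
  4x≡[x+x]+[x+x] = solve-∀
  dy<dx : dy < dx
  dy<dx = subst (dy <_) (*-comm L K)
            (*-monoʳ-< L {{>-nonZero (<-≤-trans 0<l₁ (m≤m+n l₁ l₂))}} L+r+r<K)
  dx≤z : dx ≤ z
  dx≤z = m≤m*n dx (l₁ * l₂) {{>-nonZero (*-mono-< 0<l₁ 0<l₂)}}
  d²<4z² : dx * dx + dy * dy < 4 * (z * z)
  d²<4z² = begin-strict
    dx * dx + dy * dy                <⟨ +-monoʳ-< (dx * dx) (*-mono-< dy<dx dy<dx) ⟩
    dx * dx + dx * dx                ≤⟨ m≤m+n (dx * dx + dx * dx) (dx * dx + dx * dx) ⟩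
    dx * dx + dx * dx + (dx * dx + dx * dx) ≡⟨ 4x≡[x+x]+[x+x] (dx * dx) ⟨
    4 * (dx * dx)                    ≤⟨ *-monoʳ-≤ 4 (*-mono-≤ dx≤z dx≤z) ⟩
    4 * (z * z)                      ∎
    where open ≤-Reasoning

module Layout (b : ℕ) where

  m K : ℕ
  m = suc b
  K = m + m

  row : ℕ → ℕ
  row t = t % m

  P : ℕ → Grid
  P t = point (K * t) (row t * row t)

  row<m : ∀ t → row t < m
  row<m t = m%n<n t m

  P-injective : ∀ {s t} → P s ≡ P t → s ≡ t
  P-injective {s} {t} Ps≡Pt = *-cancelˡ-≡ s t K (ℤₚ.+-injective (cong proj₁ Ps≡Pt))

  P-Apartˣ : ∀ {s t} → s < t → Apart horizontal (P s) (P t)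
  P-Apartˣ {s} {t} s<t = point-Apartˣ {y = row s * row s} {y′ = row t * row t} (*-monoʳ-< K s<t)

  P-Apartʸ : ∀ s t → row s < row t → Apart vertical (P s) (P t)
  P-Apartʸ s t rs<rt = point-Apartʸ {x = K * s} {x′ = K * t} (*-mono-< rs<rt rs<rt)

  row-+ : ∀ i s → s + row i < m → row (s + i) ≡ s + row i
  row-+ i s = n+m%d<d⇒[n+m]%d≡n+m%d s i m

  row-+-wrap : ∀ i s → m ≤ s + row i → s < m → row (s + i) ≡ s + row i ∸ m
  row-+-wrap i s = d≤n+m%d⇒[n+m]%d≡n+m%d∸d s i m

  row-+-wrap< : ∀ i s → m ≤ s + row i → s < m → row (s + i) < row i
  row-+-wrap< i s wraps s<m = subst (_< row i) (sym (row-+-wrap i s wraps s<m)) (m<o⇒m+n∸o<n s<m wraps)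

  P-on-parabola : ∀ i s → s + row i < m → P (s + i) ≡ parabola K i (row i) s
  P-on-parabola i s s+r<m = cong (λ y → point (K * (s + i)) (y * y)) (row-+ i s s+r<m)

  unwrapped-chord-misses : ∀ i l₁ l₂ → 0 < l₁ → 0 < l₂ → l₁ + l₂ + row i < m →
    ¬ SegmentHitsDisk (P i) (P (l₁ + l₂ + i)) (P (l₁ + i))
  unwrapped-chord-misses i l₁ l₂ 0<l₁ 0<l₂ L+r<m =
    subst₂ (λ B C → ¬ SegmentHitsDisk (P i) B C)
      (sym (P-on-parabola i (l₁ + l₂) L+r<m)) (sym (P-on-parabola i l₁ l₁+r<m))
      (parabola-chord-misses-disk K i (row i) l₁ l₂ 0<l₁ 0<l₂ (+-mono-< L+r<m (row<m i)))
    where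
    l₁+r<m : l₁ + row i < m
    l₁+r<m = ≤-<-trans (+-monoˡ-≤ (row i) (m≤m+n l₁ l₂)) L+r<m

  -- The row number drops by m at the wrap, so the middle vertex is the highest
  -- of the three if the wrap comes after it and the lowest otherwise.
  wrapped-chord-misses : ∀ i l₁ l₂ → 0 < l₁ → 0 < l₂ → l₁ + l₂ < m → m ≤ l₁ + l₂ + row i →
    ¬ SegmentHitsDisk (P i) (P (l₁ + l₂ + i)) (P (l₁ + i))
  wrapped-chord-misses i l₁ l₂ 0<l₁ 0<l₂ L<m m≤L+r = by-cases (l₁ + row i <? m)
    where
    A = P i
    B = P (l₁ + l₂ + i)
    C = P (l₁ + i)
    rk<ri : row (l₁ + l₂ + i) < row i
    rk<ri = row-+-wrap< i (l₁ + l₂) m≤L+r L<m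
    by-cases : Dec (l₁ + row i < m) → ¬ SegmentHitsDisk A B C
    by-cases (yes l₁+r<m) =
      before⇒¬SegmentHitsDisk vertical A B C
        (P-Apartʸ i (l₁ + i) ri<rj) (P-Apartʸ (l₁ + l₂ + i) (l₁ + i) (<-trans rk<ri ri<rj))
      where
      ri<rj : row i < row (l₁ + i)
      ri<rj = subst (row i <_) (sym (row-+ i l₁ l₁+r<m)) (m<n+m (row i) 0<l₁)
    by-cases (no l₁+r≮m) =
      beyond⇒¬SegmentHitsDisk vertical A B C
        (P-Apartʸ (l₁ + i) i (<-trans rj<rk rk<ri)) (P-Apartʸ (l₁ + i) (l₁ + l₂ + i) rj<rk)
      where
      rj<rk : row (l₁ + i) < row (l₁ + l₂ + i)
      rj<rk = subst₂ _<_ (sym (row-+-wrap i l₁ (≮⇒≥ l₁+r≮m) (≤-<-trans (m≤m+n l₁ l₂) L<m)))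
                         (sym (row-+-wrap i (l₁ + l₂) m≤L+r L<m))
                (∸-monoˡ-< (+-monoˡ-< (row i) (m<m+n l₁ 0<l₂)) (≮⇒≥ l₁+r≮m))

  split-chord-misses : ∀ i l₁ l₂ → 0 < l₁ → 0 < l₂ → l₁ + l₂ ≤ b →
    ¬ SegmentHitsDisk (P i) (P (l₁ + l₂ + i)) (P (l₁ + i))
  split-chord-misses i l₁ l₂ 0<l₁ 0<l₂ L≤b with l₁ + l₂ + row i <? m
  ... | yes L+r<m = unwrapped-chord-misses i l₁ l₂ 0<l₁ 0<l₂ L+r<m
  ... | no L+r≮m  = wrapped-chord-misses i l₁ l₂ 0<l₁ 0<l₂ (s≤s L≤b) (≮⇒≥ L+r≮m)

  inner-chord-misses : ∀ {i j k} → i < j → j < k → k ∸ i ≤ b → ¬ SegmentHitsDisk (P i) (P k) (P j)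
  inner-chord-misses {i} {j} {k} i<j j<k k∸i≤b =
    subst₂ (λ k j → ¬ SegmentHitsDisk (P i) (P k) (P j)) l₁+l₂+i≡k l₁+i≡j
      (split-chord-misses i l₁ l₂ (m<n⇒0<n∸m i<j) (m<n⇒0<n∸m j<k) l₁+l₂≤b)
    where
    l₁ = j ∸ i
    l₂ = k ∸ j
    l₁+i≡j : l₁ + i ≡ j
    l₁+i≡j = m∸n+n≡m (<⇒≤ i<j)
    l₁+l₂+i≡k : l₁ + l₂ + i ≡ k
    l₁+l₂+i≡k = begin
      l₁ + l₂ + i   ≡⟨ cong (_+ i) (+-comm l₁ l₂) ⟩
      l₂ + l₁ + i   ≡⟨ +-assoc l₂ l₁ i ⟩
      l₂ + (l₁ + i) ≡⟨ cong (l₂ +_) l₁+i≡j ⟩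
      l₂ + j        ≡⟨ m∸n+n≡m (<⇒≤ j<k) ⟩
      k             ∎
      where open ≡-Reasoning
    l₁+l₂≤b : l₁ + l₂ ≤ b
    l₁+l₂≤b = subst (_≤ b) (trans (cong (_∸ i) (sym l₁+l₂+i≡k)) (m+n∸n≡m (l₁ + l₂) i)) k∸i≤b

  short-chord-misses : ∀ {i j k} → i < k → k ∸ i ≤ b → j ≢ i → j ≢ k →
    ¬ SegmentHitsDisk (P i) (P k) (P j)
  short-chord-misses {i} {j} {k} i<k k∸i≤b j≢i j≢k with <-cmp j i | <-cmp j k
  ... | tri< j<i _ _   | _               =
    beyond⇒¬SegmentHitsDisk horizontal (P i) (P k) (P j) (P-Apartˣ j<i) (P-Apartˣ (<-trans j<i i<k))
  ... | tri≈ _ j≡i _   | _               = contradiction j≡i j≢i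
  ... | tri> _ _ i<j   | tri< j<k _ _    = inner-chord-misses i<j j<k k∸i≤b
  ... | tri> _ _ _     | tri≈ _ j≡k _    = contradiction j≡k j≢k
  ... | tri> _ _ i<j   | tri> _ _ k<j    =
    before⇒¬SegmentHitsDisk horizontal (P i) (P k) (P j) (P-Apartˣ i<j) (P-Apartˣ k<j)

  drawing : ∀ {n} {G : SimpleGraph n} → HasBandwidth G b → DiskLinkDrawing G
  drawing {n} {G} (σ , σ-injective , short) = record
    { pos      = P ∘ ix
    ; distinct = ix-injective ∘ P-injective
    ; disjoint = disks-disjoint
    ; avoid    = edges-avoid-disks
    }
    where
    ix : Fin n → ℕ
    ix v = toℕ (σ v)
    ix-injective : ∀ {u v} → ix u ≡ ix v → u ≡ v
    ix-injective = σ-injective ∘ toℕ-injective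
    disks-disjoint : ∀ u v → u ≢ v → ¬ DisksIntersect (P (ix u)) (P (ix v))
    disks-disjoint u v u≢v with <-cmp (ix u) (ix v)
    ... | tri< u<v _ _ = Apart⇒¬DisksIntersect horizontal (P (ix u)) (P (ix v)) (P-Apartˣ u<v)
    ... | tri≈ _ u≡v _ = contradiction (ix-injective u≡v) u≢v
    ... | tri> _ _ v<u = Apart⇒¬DisksIntersect horizontal (P (ix v)) (P (ix u)) (P-Apartˣ v<u) ∘ map₂ swap
    edges-avoid-disks : ∀ u v w → Adj G u v → w ≢ u → w ≢ v →
      ¬ SegmentHitsDisk (P (ix u)) (P (ix v)) (P (ix w))
    edges-avoid-disks u v w uv w≢u w≢v with <-cmp (ix u) (ix v)
    ... | tri< u<v _ _ = short-chord-misses u<v (short u v uv u<v) (w≢u ∘ ix-injective) (w≢v ∘ ix-injective)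
    ... | tri≈ _ u≡v _ = contradiction (subst (Adj G u) (sym (ix-injective u≡v)) uv) (irrefl G)
    ... | tri> _ _ v<u =
      short-chord-misses v<u (short v u (SimpleGraph.sym G uv) v<u) (w≢v ∘ ix-injective) (w≢u ∘ ix-injective)
      ∘ SegmentHitsDisk-sym (P (ix u)) (P (ix v)) (P (ix w))

  drawing-on-grid : ∀ {n} {G : SimpleGraph n} (bw : HasBandwidth G b) →
    OnGrid {n} {G} (drawing bw) (suc (K * pred n)) (suc (b * b))
  drawing-on-grid (σ , _ , _) = s≤s z≤n , s≤s z≤n , ℤ.+ 0 , ℤ.+ 0 , λ v →
    ℤ.+≤+ z≤n , ℤ.+≤+ (*-monoʳ-≤ K (<⇒≤pred (toℕ<n (σ v)))) ,
    ℤ.+≤+ z≤n , ℤ.+≤+ (*-mono-≤ (≤-pred (row<m (toℕ (σ v)))) (≤-pred (row<m (toℕ (σ v)))))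

width-bound : ∀ n b → 1 ≤ n → 1 ≤ b → suc ((suc b + suc b) * pred n) ≤ 4 * b * n
width-bound (suc n) (suc b) _ _ =
  subst (suc ((suc (suc b) + suc (suc b)) * n) ≤_) (sym (e n b)) (m≤m+n _ _)
  where
  e : ∀ n b → 4 * suc b * suc n ≡ suc ((suc (suc b) + suc (suc b)) * n) + (2 * b * n + 4 * b + 3)
  e = solve-∀

height-bound : ∀ b → 1 ≤ b → suc (b * b) ≤ 4 * (b * b)
height-bound (suc b) _ = subst (suc (suc b * suc b) ≤_) (sym (e b)) (m≤m+n _ _)
  where
  e : ∀ b → 4 * (suc b * suc b) ≡ suc (suc b * suc b) + (3 * b * b + 6 * b + 2)
  e = solve-∀

theorem5 : ∃[ c ] (0 < c × (∀ (n b : ℕ) → 1 ≤ n → 1 ≤ b → (G : SimpleGraph n) → HasBandwidth G b → ∃[ D ] ∃[ W ] ∃[ H ] (OnGrid {n} {G} D W H × W ≤ c * b * n × H ≤ c * (b * b))))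
theorem5 = 4 , s≤s z≤n , λ n b 1≤n 1≤b G bw →
  Layout.drawing b bw , _ , _ , Layout.drawing-on-grid b {G = G} bw , width-bound n b 1≤n 1≤b , height-bound b 1≤b
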